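{- Let $R:\mathbf{E}\to\mathbf{B}$ be a residual multi-opfibration, let $f:b\to b'$ be a morphism of $\mathbf{B}$ and $e$ an object of $\mathbf{E}$ with $R(e)=b$. Let $\rho_j(f):e\to e'_j$ and $\rho_k(f):e\to e'_k$ be two residual multi-op-Cartesian liftings of $f$ at $e$ with residues $f_{\star j}$ and $f_{\star k}$ respectively. If there is a morphism $\beta_k:e'_k\to e'_j$ of $\mathbf{E}$ with $\rho_j(f)=\beta_k\circ\rho_k(f)$ and $f_{\star j}=R(\beta_k)\circ f_{\star k}$, then $\beta_k$ is an isomorphism of $\mathbf{E}$ and $R(\beta_k)$ is an isomorphism of $\mathbf{B}$.
   Context: A functor $R:\mathbf{E}\to\mathbf{B}$ is a residual multi-opfibration if for every morphism $f:b\to b'$ of $\mathbf{B}$ and every object $e$ of $\mathbf{E}$ with $R(e)=b$ there exists a (possibly empty) family $\{\rho_j(f):e\to e'_j\}_{j\in J_{f;e}}$ of morphisms of $\mathbf{E}$ (residual multi-op-Cartesian liftings), each equipped with a morphism $f_{\star j}:b'\to R(e'_j)$ of $\mathbf{B}$ (its residue) such that $R(\rho_j(f))=f_{\star j}\circ f$, satisfying: (a) for every $\alpha:e\to e''$ in $\mathbf{E}$ and $g:b'\to R(e'')$ in $\mathbf{B}$ with $R(\alpha)=g\circ f$ there exist $j\in J_{f;e}$ and a unique $\beta_j:e'_j\to e''$ with $\alpha=\beta_j\circ\rho_j(f)$ and $g=R(\beta_j)\circ f_{\star j}$; (b) (essential uniqueness) if moreover some $k\in J_{f;e}$ admits $\beta_k:e'_k\to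 e''$ with $\alpha=\beta_k\circ\rho_k(f)$ and $g=R(\beta_k)\circ f_{\star k}$, then there is a unique isomorphism $\phi:e'_j\to e'_k$ with $\rho_k(f)=\phi\circ\rho_j(f)$, $\beta_j=\beta_k\circ\phi$ and $f_{\star k}=R(\phi)\circ f_{\star j}$. -}

module Defs where

open import Level using (Level; _⊔_; suc)
open import Relation.Binary.PropositionalEquality using (_≡_)
open import Data.Product using (Σ; _×_; Σ-syntax)

record Category (o ℓ : Level) : Set (suc (o ⊔ ℓ)) where
  infixr 9 _∘_
  field
    Obj : Set o
    Hom : Obj → Obj → Set ℓ
    id  : ∀ {A} → Hom A A
    _∘_ : ∀ {A B C} → Hom B C → Hom A B → Hom A C
    identityˡ : ∀ {A B} {f : Hom A B} → id ∘ f ≡ f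
    identityʳ : ∀ {A B} {f : Hom A B} → f ∘ id ≡ f
    assoc : ∀ {A B C D} {f : Hom A B} {g : Hom B C} {h : Hom C D}
          → (h ∘ g) ∘ f ≡ h ∘ (g ∘ f)

IsIso : ∀ {o ℓ} (C : Category o ℓ) {A B : Category.Obj C} → Category.Hom C A B → Set ℓ
IsIso C {A} {B} f = Σ[ g ∈ Hom B A ] ((g ∘ f ≡ id) × (f ∘ g ≡ id))
  where open Category C

record Functor {o ℓ o′ ℓ′} (C : Category o ℓ) (D : Category o′ ℓ′)
       : Set (o ⊔ ℓ ⊔ o′ ⊔ ℓ′) where
  private
    module C = Category C
    module D = Category D
  field
    F₀ : C.Obj → D.Obj
    F₁ : ∀ {A B} → C.Hom A B → D.Hom (F₀ A) (F₀ B)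
    identity : ∀ {A} → F₁ (C.id {A}) ≡ D.id
    homomorphism : ∀ {A B C′} {f : C.Hom A B} {g : C.Hom B C′}
                 → F₁ (g C.∘ f) ≡ F₁ g D.∘ F₁ f

-- Residual multi-opfibration structure on a functor R : E → B.
-- An object e of E with R(e) = b and f : b → b' is rendered as
-- f : Hom_B (R₀ e) b'.  The index family J_{f;e} lives in Set ι.
record ResidualMultiOpfibration {o ℓ o′ ℓ′} (ι : Level)
       {E : Category o ℓ} {B : Category o′ ℓ′} (R : Functor E B)
       : Set (o ⊔ ℓ ⊔ o′ ⊔ ℓ′ ⊔ suc ι) where
  private
    module E = Category E
    module B = Category B
  open Functor R
  field
    J       : ∀ {e b′} → B.Hom (F₀ e) b′ → Set ι
    target  : ∀ {e b′} (f : B.Hom (F₀ e) b′) → J f → E.Obj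
    ρ       : ∀ {e b′} (f : B.Hom (F₀ e) b′) (j : J f) → E.Hom e (target f j)
    residue : ∀ {e b′} (f : B.Hom (F₀ e) b′) (j : J f) → B.Hom b′ (F₀ (target f j))
    lift-over : ∀ {e b′} (f : B.Hom (F₀ e) b′) (j : J f)
              → F₁ (ρ f j) ≡ residue f j B.∘ f
    factor : ∀ {e b′ e″} (f : B.Hom (F₀ e) b′)
               (α : E.Hom e e″) (g : B.Hom b′ (F₀ e″))
           → F₁ α ≡ g B.∘ f
           → Σ[ j ∈ J f ] Σ[ β ∈ E.Hom (target f j) e″ ]
               ( (α ≡ β E.∘ ρ f j) × (g ≡ F₁ β B.∘ residue f j)
               × (∀ (β′ : E.Hom (target f j) e″)
                  → α ≡ β′ E.∘ ρ f j → g ≡ F₁ β′ B.∘ residue f j → β′ ≡ β) )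
    essentially-unique :
        ∀ {e b′ e″} (f : B.Hom (F₀ e) b′)
          (α : E.Hom e e″) (g : B.Hom b′ (F₀ e″))
          (j k : J f)
          (βj : E.Hom (target f j) e″) (βk : E.Hom (target f k) e″)
      → α ≡ βj E.∘ ρ f j → g ≡ F₁ βj B.∘ residue f j
      → α ≡ βk E.∘ ρ f k → g ≡ F₁ βk B.∘ residue f k
      → Σ[ φ ∈ E.Hom (target f j) (target f k) ]
          ( IsIso E φ
          × (ρ f k ≡ φ E.∘ ρ f j) × (βj ≡ βk E.∘ φ)
          × (residue f k ≡ F₁ φ B.∘ residue f j)
          × (∀ (φ′ : E.Hom (target f j) (target f k)) → IsIso E φ′
             → ρ f k ≡ φ′ E.∘ ρ f j → βj ≡ βk E.∘ φ′
             → residue f k ≡ F₁ φ′ B.∘ residue f j → φ′ ≡ φ) )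

{-# OPTIONS --safe #-}
module Submission where

-- Both ρ_j(f) = id ∘ ρ_j(f) and ρ_j(f) = β_k ∘ ρ_k(f) factor (ρ_j(f), f_⋆j)
-- through a lifting, so essential uniqueness yields an isomorphism φ with
-- id = β_k ∘ φ.  A retraction of an isomorphism is its inverse, hence an
-- isomorphism, and functors preserve isomorphisms.

open import Defs
open import Level using (Level)
open import Relation.Binary.PropositionalEquality
  using (_≡_; sym; trans; cong; module ≡-Reasoning)
open import Data.Product using (Σ-syntax; _×_; _,_)

module _ {o ℓ} (C : Category o ℓ) where
  open Category C
  open ≡-Reasoning

  retraction-of-iso-is-iso : ∀ {A B} {φ : Hom A B} {β : Hom B A}
                           → IsIso C φ → β ∘ φ ≡ id → IsIso C β
  retraction-of-iso-is-iso {φ = φ} {β} (ψ , ψφ≡id , φψ≡id) βφ≡id =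
    φ , φβ≡id , βφ≡id
    where
    β≡ψ : β ≡ ψ
    β≡ψ = begin
      β             ≡⟨ sym identityʳ ⟩
      β ∘ id        ≡⟨ cong (β ∘_) (sym φψ≡id) ⟩
      β ∘ (φ ∘ ψ)   ≡⟨ sym assoc ⟩
      (β ∘ φ) ∘ ψ   ≡⟨ cong (_∘ ψ) βφ≡id ⟩
      id ∘ ψ        ≡⟨ identityˡ ⟩
      ψ             ∎

    φβ≡id : φ ∘ β ≡ id
    φβ≡id = trans (cong (φ ∘_) β≡ψ) φψ≡id

module _ {o ℓ o′ ℓ′} {C : Category o ℓ} {D : Category o′ ℓ′} (F : Functor C D) where
  private
    module C = Category C
    module D = Category D
  open Functor F

  F₁-resp-inverse : ∀ {A B} {f : C.Hom A B} {g : C.Hom B A}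
                  → g C.∘ f ≡ C.id → F₁ g D.∘ F₁ f ≡ D.id
  F₁-resp-inverse gf≡id = trans (sym homomorphism) (trans (cong F₁ gf≡id) identity)

  F₁-resp-IsIso : ∀ {A B} {f : C.Hom A B} → IsIso C f → IsIso D (F₁ f)
  F₁-resp-IsIso (g , gf≡id , fg≡id) = F₁ g , F₁-resp-inverse gf≡id , F₁-resp-inverse fg≡id

module _ {o ℓ o′ ℓ′ ι} {E : Category o ℓ} {B : Category o′ ℓ′}
         {R : Functor E B} (M : ResidualMultiOpfibration ι R) where
  private
    module E = Category E
    module B = Category B
  open Functor R
  open ResidualMultiOpfibration M

  comparison-has-iso-section :
      ∀ {e b′} (f : B.Hom (F₀ e) b′) (j k : J f)
        (β : E.Hom (target f k) (target f j))
    → ρ f j ≡ β E.∘ ρ f k → residue f j ≡ F₁ β B.∘ residue f k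
    → Σ[ φ ∈ E.Hom (target f j) (target f k) ] (IsIso E φ × (β E.∘ φ ≡ E.id))
  comparison-has-iso-section f j k β ρ-factors residue-factors
    with essentially-unique f (ρ f j) (residue f j) j k E.id β
           (sym E.identityˡ) residue-factors-through-id ρ-factors residue-factors
    where
    residue-factors-through-id : residue f j ≡ F₁ E.id B.∘ residue f j
    residue-factors-through-id = sym (trans (cong (B._∘ residue f j) identity) B.identityˡ)
  ... | φ , φ-iso , _ , id≡βφ , _ = φ , φ-iso , sym id≡βφ

corollary2 : ∀ {o ℓ o′ ℓ′ ι : Level} {E : Category o ℓ} {B : Category o′ ℓ′}
               (R : Functor E B) (M : ResidualMultiOpfibration ι R)
               {e : Category.Obj E} {b′ : Category.Obj B}
               (f : Category.Hom B (Functor.F₀ R e) b′)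
               (j k : ResidualMultiOpfibration.J M f)
               (βk : Category.Hom E (ResidualMultiOpfibration.target M f k)
                                    (ResidualMultiOpfibration.target M f j))
             → ResidualMultiOpfibration.ρ M f j
                 ≡ Category._∘_ E βk (ResidualMultiOpfibration.ρ M f k)
             → ResidualMultiOpfibration.residue M f j
                 ≡ Category._∘_ B (Functor.F₁ R βk) (ResidualMultiOpfibration.residue M f k)
             → IsIso E βk × IsIso B (Functor.F₁ R βk)
corollary2 {E = E} R M f j k βk ρ-factors residue-factors =
  βk-iso , F₁-resp-IsIso R βk-iso
  where
  βk-iso : IsIso E βk
  βk-iso with comparison-has-iso-section M f j k βk ρ-factors residue-factors
  ... | _ , φ-iso , βkφ≡id = retraction-of-iso-is-iso E φ-iso βkφ≡id
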